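{- Let $n\ge 1$, let $F(x,y)$ be a symmetric homogeneous polynomial of degree $2n-2$ in two variables, and let $w_0,\dots,w_n$ be distinct complex numbers. Then $$\sum_{0\le i<j\le n}\frac{F(w_i,w_j)}{\prod_{0\le k\le n,\ k\ne i,j}(w_i-w_k)(w_j-w_k)}$$ is independent of $w_0,\dots,w_n$ and equals the coefficient of $x^{n-1}$ in $(1-x)F(x,1)$. -}

module Defs where

open import Level using (Level; _⊔_) renaming (suc to lsuc)
open import Algebra.Bundles using (CommutativeRing)
open import Data.Nat using (ℕ; zero; suc; _∸_; _<?_)
open import Data.Fin using (Fin; toℕ; _≟_)
open import Relation.Nullary using (¬_; Dec; yes; no)
open import Relation.Binary.PropositionalEquality using (_≡_)

-- A field, with a total inverse function whose value at 0 is irrelevant: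
-- x * x⁻¹ ≈ 1 for every x ≉ 0, and 0 ≉ 1.
record Field (c ℓ : Level) : Set (lsuc (c ⊔ ℓ)) where
  field
    commutativeRing : CommutativeRing c ℓ
  open CommutativeRing commutativeRing public
  infix 8 _⁻¹
  field
    _⁻¹        : Carrier → Carrier
    ⁻¹-inverse : ∀ x → ¬ (x ≈ 0#) → x * (x ⁻¹) ≈ 1#
    0≉1        : ¬ (0# ≈ 1#)

-- The degree 2n-2 (truncated subtraction; n ≥ 1 is assumed where used).
deg : ℕ → ℕ
deg n = 2 Data.Nat.* n ∸ 2

module FieldOps {c ℓ : Level} (K : Field c ℓ) where
  open Field K public hiding (zero)

  infixl 6 _−_
  _−_ : Carrier → Carrier → Carrier
  x − y = x + (- y)

  infixl 7 _÷_
  _÷_ : Carrier → Carrier → Carrier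
  x ÷ y = x * (y ⁻¹)

  infixr 8 _^_
  _^_ : Carrier → ℕ → Carrier
  x ^ zero  = 1#
  x ^ suc k = x * (x ^ k)

  Σ : (m : ℕ) → (Fin m → Carrier) → Carrier
  Σ zero    f = 0#
  Σ (suc m) f = f Fin.zero + Σ m (λ i → f (Fin.suc i))

  Π : (m : ℕ) → (Fin m → Carrier) → Carrier
  Π zero    f = 1#
  Π (suc m) f = f Fin.zero * Π m (λ i → f (Fin.suc i))

  -- A homogeneous polynomial of degree d in two variables x, y, given by its
  -- coefficients:  F(x,y) = Σ_{a=0}^{d} c_a x^a y^(d-a).
  HomPoly : ℕ → Set c
  HomPoly d = Fin (suc d) → Carrier

  evalHom : (d : ℕ) → HomPoly d → Carrier → Carrier → Carrier
  evalHom d cf x y = Σ (suc d) (λ a → cf a * (x ^ toℕ a) * (y ^ (d ∸ toℕ a)))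

  -- F is symmetric, F(x,y) = F(y,x) as polynomials: c_a = c_{d-a}.
  IsSymmetric : (d : ℕ) → HomPoly d → Set ℓ
  IsSymmetric d cf = ∀ (a b : Fin (suc d)) → toℕ a Data.Nat.+ toℕ b ≡ d → cf a ≈ cf b

  UPoly : Set c
  UPoly = ℕ → Carrier

  -- F(x,1) as a univariate polynomial: coefficient of x^k is c_k (0 for k > d).
  dehom : (d : ℕ) → HomPoly d → UPoly
  dehom d cf k with k <? suc d
  ... | yes k<d = cf (Data.Fin.fromℕ< k<d)
  ... | no  _   = 0#

  oneMinusX* : UPoly → UPoly
  oneMinusX* p zero    = p zero
  oneMinusX* p (suc k) = p (suc k) − p k

  coeff : UPoly → ℕ → Carrier
  coeff p k = p k

  ifLt : {m : ℕ} → Fin m → Fin m → Carrier → Carrier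
  ifLt i j v with toℕ i <? toℕ j
  ... | yes _ = v
  ... | no  _ = 0#

  unlessEq : {m : ℕ} → Fin m → Fin m → Fin m → Carrier → Carrier
  unlessEq k i j v with k ≟ i | k ≟ j
  ... | yes _ | _     = 1#
  ... | no _  | yes _ = 1#
  ... | no _  | no _  = v

  theSum : (n d : ℕ) → HomPoly d → (Fin (suc n) → Carrier) → Carrier
  theSum n d cf w =
    Σ (suc n) λ i → Σ (suc n) λ j → ifLt i j
      (evalHom d cf (w i) (w j) ÷
        Π (suc n) (λ k → unlessEq k i j ((w i − w k) * (w j − w k))))

{-# OPTIONS --safe #-}

-- Let P_i = ∏_{k≠i} (w_i − w_k) and S_e = Σ_i w_i^e / P_i. The denominator of the
-- (i,j) term is P_i P_j / ((w_i − w_j)(w_j − w_i)), and (w_i − w_j)(w_j − w_i) =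
-- (w_j − w_i) w_i + (w_i − w_j) w_j, so by the symmetry of F the sum over i < j is the
-- full double sum Σ_{i,j} F(w_i,w_j) (w_j − w_i) w_i / (P_i P_j), whose diagonal
-- vanishes. Expanding F = Σ_a c_a x^a y^(2n−2−a) turns it into
-- Σ_a c_a (S_{a+1} S_{2n−1−a} − S_{a+2} S_{2n−2−a}). For n+1 distinct points S_e = 0
-- when e < n and S_n = 1, by induction on the number of points from
-- S_{e+1}(w) = S_e(w_1,…,w_n) + w_0 S_e(w) and the symmetry of S_e in w_0 and w_1.
-- Hence S_p S_q = [p = n] whenever p + q = 2n, and only c_{n−1} − c_{n−2} survives.

module Submission where

open import Defs
open import Level using (Level)
open import Data.Nat using (ℕ; zero; suc; _≤_; _<_; _<?_; _∸_; z≤n; s≤s)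
import Data.Nat as ℕ
import Data.Nat.Properties as ℕₚ
open import Data.Fin using (Fin; zero; suc; toℕ; fromℕ<; opposite; _≟_)
import Data.Fin.Properties as Finₚ
open import Data.Fin.Permutation using (reverse)
open import Data.Product using (_×_; _,_)
open import Data.Empty using (⊥-elim)
open import Function using (_∘_)
open import Function.Definitions using (Injective)
open import Relation.Nullary using (¬_; yes; no)
open import Relation.Binary.Definitions using (tri<; tri≈; tri>)
open import Relation.Binary.PropositionalEquality as ≡ using (_≡_; _≢_)
import Algebra.Properties.AbelianGroup as AbelianGroupProperties
import Algebra.Properties.CommutativeMonoid.Sum as CommutativeMonoidSum
import Algebra.Properties.CommutativeSemigroup as CommutativeSemigroupProperties
import Algebra.Properties.Group as GroupProperties
import Algebra.Properties.Ring as RingProperties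
import Algebra.Properties.Semiring.Sum as SemiringSum
import Algebra.Solver.CommutativeMonoid as CommutativeMonoidSolver
import Relation.Binary.Reasoning.Setoid as SetoidReasoning

module _ {c ℓ : Level} (K : Field c ℓ) where
  open FieldOps K
  open SetoidReasoning setoid
  open SemiringSum semiring
    using (sum; sum-syntax; sum-cong-≋; sum-cong-≗; sum-replicate-zero;
           ∑-distrib-+; ∑-comm; ∑-permute; *-distribˡ-sum; *-distribʳ-sum)
  open CommutativeMonoidSum *-commutativeMonoid using ()
    renaming (sum to product; sum-cong-≋ to product-cong; ∑-distrib-+ to product-distrib-*)
  open CommutativeSemigroupProperties *-commutativeSemigroup
    using (interchange; x∙yz≈y∙xz; x∙yz≈z∙yx; xy∙z≈xz∙y)
  open CommutativeSemigroupProperties +-commutativeSemigroup using ()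
    renaming (x∙yz≈y∙xz to x+[y+z]≈y+[x+z])
  open GroupProperties +-group
    using (ε⁻¹≈ε; x∙y⁻¹≈ε⇒x≈y; x≈y⇒x∙y⁻¹≈ε; ∙-cancelˡ; //-rightDividesˡ)
  open RingProperties ring using (-1*x≈-x; -‿distribˡ-*; x[y-z]≈xy-xz; [y-z]x≈yx-zx)
  open AbelianGroupProperties +-abelianGroup using (⁻¹-anti-homo‿-)
  open CommutativeMonoidSolver *-commutativeMonoid using (solve; _⊕_; _⊜_)

  x≉y⇒x−y≉0 : ∀ {x y} → x ≉ y → x − y ≉ 0#
  x≉y⇒x−y≉0 x≉y = x≉y ∘ x∙y⁻¹≈ε⇒x≈y _ _

  x*y≈[x−z]*y+z*y : ∀ x y z → x * y ≈ (x − z) * y + z * y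
  x*y≈[x−z]*y+z*y x y z = begin
    x * y                 ≈⟨ *-congʳ (//-rightDividesˡ z x) ⟨
    ((x − z) + z) * y     ≈⟨ distribʳ y (x − z) z ⟩
    (x − z) * y + z * y   ∎

  [a−b]*[b−a]≈[b−a]*a+[a−b]*b : ∀ a b → (a − b) * (b − a) ≈ (b − a) * a + (a − b) * b
  [a−b]*[b−a]≈[b−a]*a+[a−b]*b a b = begin
    (a − b) * (b − a)               ≈⟨ *-comm (a − b) (b − a) ⟩
    (b − a) * (a − b)               ≈⟨ x[y-z]≈xy-xz (b − a) a b ⟩
    (b − a) * a − (b − a) * b       ≈⟨ +-congˡ (-‿distribˡ-* (b − a) b) ⟩
    (b − a) * a + - (b − a) * b     ≈⟨ +-congˡ (*-congʳ (⁻¹-anti-homo‿- b a)) ⟩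
    (b − a) * a + (a − b) * b       ∎

  -- X, Y stand for x^a, y^(d−a), and p, q for 1/P_i, 1/P_j.
  monomial-split : ∀ c X Y x y p q →
    c * X * Y * ((y − x) * x) * (p * q) ≈ c * (x * X * p * (y * Y * q) − x * (x * X) * p * (Y * q))
  monomial-split c X Y x y p q = begin
    c * X * Y * ((y − x) * x) * (p * q)
      ≈⟨ solve 3 (λ A B C → (A ⊕ B) ⊕ C ⊜ B ⊕ (A ⊕ C)) refl (c * X * Y) ((y − x) * x) (p * q) ⟩
    (y − x) * x * (c * X * Y * (p * q))
      ≈⟨ *-congʳ ([y-z]x≈yx-zx x y x) ⟩
    (y * x − x * x) * (c * X * Y * (p * q))
      ≈⟨ [y-z]x≈yx-zx _ (y * x) (x * x) ⟩
    y * x * (c * X * Y * (p * q)) − x * x * (c * X * Y * (p * q))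
      ≈⟨ +-cong (solve 7 (λ c X Y x y p q → (y ⊕ x) ⊕ (((c ⊕ X) ⊕ Y) ⊕ (p ⊕ q))
                                             ⊜ c ⊕ (((x ⊕ X) ⊕ p) ⊕ ((y ⊕ Y) ⊕ q))) refl c X Y x y p q)
                (-‿cong (solve 6 (λ c X Y x p q → (x ⊕ x) ⊕ (((c ⊕ X) ⊕ Y) ⊕ (p ⊕ q))
                                                  ⊜ c ⊕ (((x ⊕ (x ⊕ X)) ⊕ p) ⊕ (Y ⊕ q))) refl c X Y x p q)) ⟩
    c * (x * X * p * (y * Y * q)) − c * (x * (x * X) * p * (Y * q))
      ≈⟨ x[y-z]≈xy-xz c _ _ ⟨
    c * (x * X * p * (y * Y * q) − x * (x * X) * p * (Y * q))   ∎

  x*y÷y≈x : ∀ {x y} → y ≉ 0# → x * y ÷ y ≈ x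
  x*y÷y≈x {x} {y} y≉0 = begin
    x * y * y ⁻¹     ≈⟨ *-assoc x y (y ⁻¹) ⟩
    x * (y * y ⁻¹)   ≈⟨ *-congˡ (⁻¹-inverse y y≉0) ⟩
    x * 1#           ≈⟨ *-identityʳ x ⟩
    x                ∎

  x≉0∧y≉0⇒x*y≉0 : ∀ {x y} → x ≉ 0# → y ≉ 0# → x * y ≉ 0#
  x≉0∧y≉0⇒x*y≉0 {x} {y} x≉0 y≉0 xy≈0 = x≉0 (begin
    x            ≈⟨ x*y÷y≈x y≉0 ⟨
    x * y ÷ y    ≈⟨ *-congʳ xy≈0 ⟩
    0# ÷ y       ≈⟨ zeroˡ (y ⁻¹) ⟩
    0#           ∎)

  x≉0∧x*y≈0⇒y≈0 : ∀ {x y} → x ≉ 0# → x * y ≈ 0# → y ≈ 0#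
  x≉0∧x*y≈0⇒y≈0 {x} {y} x≉0 xy≈0 = begin
    y            ≈⟨ x*y÷y≈x x≉0 ⟨
    y * x ÷ x    ≈⟨ *-congʳ (trans (*-comm y x) xy≈0) ⟩
    0# ÷ x       ≈⟨ zeroˡ (x ⁻¹) ⟩
    0#           ∎

  x≉y∧x*z≈y*z⇒z≈0 : ∀ {x y z} → x ≉ y → x * z ≈ y * z → z ≈ 0#
  x≉y∧x*z≈y*z⇒z≈0 {x} {y} {z} x≉y xz≈yz = x≉0∧x*y≈0⇒y≈0 (x≉y⇒x−y≉0 x≉y) (begin
    (x − y) * z      ≈⟨ [y-z]x≈yx-zx z x y ⟩
    x * z − y * z    ≈⟨ x≈y⇒x∙y⁻¹≈ε xz≈yz ⟩
    0#               ∎)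

  ⁻¹-unique : ∀ {x y} → x * y ≈ 1# → y ≈ x ⁻¹
  ⁻¹-unique {x} {y} xy≈1 = begin
    y            ≈⟨ x*y÷y≈x x≉0 ⟨
    y * x ÷ x    ≈⟨ *-congʳ (trans (*-comm y x) xy≈1) ⟩
    1# ÷ x       ≈⟨ *-identityˡ (x ⁻¹) ⟩
    x ⁻¹         ∎
    where
    x≉0 : x ≉ 0#
    x≉0 x≈0 = 0≉1 (trans (sym (zeroˡ y)) (trans (*-congʳ (sym x≈0)) xy≈1))

  ⁻¹-cong : ∀ {x y} → x ≉ 0# → x ≈ y → x ⁻¹ ≈ y ⁻¹
  ⁻¹-cong {x} {y} x≉0 x≈y = ⁻¹-unique (trans (*-congʳ (sym x≈y)) (⁻¹-inverse x x≉0))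

  ⁻¹-distrib-* : ∀ {x y} → x ≉ 0# → y ≉ 0# → (x * y) ⁻¹ ≈ x ⁻¹ * y ⁻¹
  ⁻¹-distrib-* {x} {y} x≉0 y≉0 = sym (⁻¹-unique (begin
    x * y * (x ⁻¹ * y ⁻¹)       ≈⟨ interchange x y (x ⁻¹) (y ⁻¹) ⟩
    x * x ⁻¹ * (y * y ⁻¹)       ≈⟨ *-cong (⁻¹-inverse x x≉0) (⁻¹-inverse y y≉0) ⟩
    1# * 1#                     ≈⟨ *-identityˡ 1# ⟩
    1#                          ∎))

  x*y≈z⇒x⁻¹≈y÷z : ∀ {x y z} → x * y ≈ z → z ≉ 0# → x ⁻¹ ≈ y ÷ z
  x*y≈z⇒x⁻¹≈y÷z {x} {y} {z} xy≈z z≉0 = sym (⁻¹-unique (begin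
    x * (y * z ⁻¹)   ≈⟨ *-assoc x y (z ⁻¹) ⟨
    x * y * z ⁻¹     ≈⟨ *-congʳ xy≈z ⟩
    z * z ⁻¹         ≈⟨ ⁻¹-inverse z z≉0 ⟩
    1#               ∎))

  x*[y÷xz]≈y÷z : ∀ {x y z} → x ≉ 0# → z ≉ 0# → x * (y ÷ (x * z)) ≈ y ÷ z
  x*[y÷xz]≈y÷z {x} {y} {z} x≉0 z≉0 = begin
    x * (y * (x * z) ⁻¹)        ≈⟨ *-congˡ (*-congˡ (⁻¹-distrib-* x≉0 z≉0)) ⟩
    x * (y * (x ⁻¹ * z ⁻¹))     ≈⟨ x∙yz≈y∙xz x y _ ⟩
    y * (x * (x ⁻¹ * z ⁻¹))     ≈⟨ *-congˡ (*-assoc x (x ⁻¹) (z ⁻¹)) ⟨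
    y * (x * x ⁻¹ * z ⁻¹)       ≈⟨ *-congˡ (*-congʳ (⁻¹-inverse x x≉0)) ⟩
    y * (1# * z ⁻¹)             ≈⟨ *-congˡ (*-identityˡ (z ⁻¹)) ⟩
    y * z ⁻¹                    ∎

  Σ≡sum : ∀ m (f : Fin m → Carrier) → Σ m f ≡ sum f
  Σ≡sum zero    f = ≡.refl
  Σ≡sum (suc m) f = ≡.cong (f zero +_) (Σ≡sum m (f ∘ suc))

  Π≡product : ∀ m (f : Fin m → Carrier) → Π m f ≡ product f
  Π≡product zero    f = ≡.refl
  Π≡product (suc m) f = ≡.cong (f zero *_) (Π≡product m (f ∘ suc))

  ∑-0 : ∀ {m} {f : Fin m → Carrier} → (∀ i → f i ≈ 0#) → sum f ≈ 0#
  ∑-0 {m} f≈0 = trans (sum-cong-≋ f≈0) (sum-replicate-zero m)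

  ∑-distrib-− : ∀ {m} (f g : Fin m → Carrier) → ∑[ i < m ] (f i − g i) ≈ sum f − sum g
  ∑-distrib-− {m} f g = begin
    ∑[ i < m ] (f i − g i)            ≈⟨ ∑-distrib-+ f (λ i → - g i) ⟩
    sum f + ∑[ i < m ] (- g i)        ≈⟨ +-congˡ (sum-cong-≋ (λ i → -1*x≈-x (g i))) ⟨
    sum f + ∑[ i < m ] (- 1# * g i)   ≈⟨ +-congˡ (*-distribˡ-sum (- 1#) g) ⟨
    sum f + - 1# * sum g              ≈⟨ +-congˡ (-1*x≈-x (sum g)) ⟩
    sum f − sum g                     ∎

  ∑∑-distrib-+ : ∀ {m} (f g : Fin m → Fin m → Carrier) →
    ∑[ i < m ] ∑[ j < m ] (f i j + g i j) ≈ ∑[ i < m ] ∑[ j < m ] f i j + ∑[ i < m ] ∑[ j < m ] g i j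
  ∑∑-distrib-+ {m} f g = trans (sum-cong-≋ (λ i → ∑-distrib-+ (f i) (g i)))
                                (∑-distrib-+ (λ i → ∑[ j < m ] f i j) (λ i → ∑[ j < m ] g i j))

  ∑∑-separable : ∀ {m k} (f : Fin m → Carrier) (g : Fin k → Carrier) →
                 ∑[ i < m ] ∑[ j < k ] (f i * g j) ≈ sum f * sum g
  ∑∑-separable f g = sym (trans (*-distribʳ-sum (sum g) f)
                                (sum-cong-≋ (λ i → *-distribˡ-sum (f i) g)))

  ∑∑-separable-− : ∀ {m} (f g f′ g′ : Fin m → Carrier) →
    ∑[ i < m ] ∑[ j < m ] (f i * g j − f′ i * g′ j) ≈ sum f * sum g − sum f′ * sum g′
  ∑∑-separable-− {m} f g f′ g′ = begin
    ∑[ i < m ] ∑[ j < m ] (f i * g j − f′ i * g′ j)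
      ≈⟨ sum-cong-≋ (λ i → ∑-distrib-− (λ j → f i * g j) (λ j → f′ i * g′ j)) ⟩
    ∑[ i < m ] (∑[ j < m ] (f i * g j) − ∑[ j < m ] (f′ i * g′ j))
      ≈⟨ ∑-distrib-− (λ i → ∑[ j < m ] (f i * g j)) (λ i → ∑[ j < m ] (f′ i * g′ j)) ⟩
    ∑[ i < m ] ∑[ j < m ] (f i * g j) − ∑[ i < m ] ∑[ j < m ] (f′ i * g′ j)
      ≈⟨ +-cong (∑∑-separable f g) (-‿cong (∑∑-separable f′ g′)) ⟩
    sum f * sum g − sum f′ * sum g′   ∎

  product-≉0 : ∀ {m} (f : Fin m → Carrier) → (∀ i → f i ≉ 0#) → product f ≉ 0#
  product-≉0 {zero}  f f≉0 = 0≉1 ∘ sym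
  product-≉0 {suc m} f f≉0 = x≉0∧y≉0⇒x*y≉0 (f≉0 zero) (product-≉0 (f ∘ suc) (f≉0 ∘ suc))

  unless : ∀ {m} → Fin m → Fin m → Carrier → Carrier
  unless zero    zero    v = 1#
  unless zero    (suc i) v = v
  unless (suc k) zero    v = v
  unless (suc k) (suc i) v = unless k i v

  unless-≡ : ∀ {m} (i : Fin m) v → unless i i v ≡ 1#
  unless-≡ zero    v = ≡.refl
  unless-≡ (suc i) v = unless-≡ i v

  unless-≢ : ∀ {m} {k i : Fin m} v → k ≢ i → unless k i v ≡ v
  unless-≢ {k = zero}  {zero}  v k≢i = ⊥-elim (k≢i ≡.refl)
  unless-≢ {k = zero}  {suc i} v k≢i = ≡.refl
  unless-≢ {k = suc k} {zero}  v k≢i = ≡.refl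
  unless-≢ {k = suc k} {suc i} v k≢i = unless-≢ v (k≢i ∘ ≡.cong suc)

  unless-1# : ∀ {m} (k i : Fin m) → unless k i 1# ≡ 1#
  unless-1# zero    zero    = ≡.refl
  unless-1# zero    (suc i) = ≡.refl
  unless-1# (suc k) zero    = ≡.refl
  unless-1# (suc k) (suc i) = unless-1# k i

  product-extract : ∀ {m} (g : Fin m → Carrier) i → product g ≈ g i * product (λ k → unless k i (g k))
  product-extract g zero    = *-congˡ (sym (*-identityˡ _))
  product-extract g (suc i) = begin
    g zero * product (g ∘ suc)
      ≈⟨ *-congˡ (product-extract (g ∘ suc) i) ⟩
    g zero * (g (suc i) * product (λ k → unless k i (g (suc k))))
      ≈⟨ x∙yz≈y∙xz _ _ _ ⟩
    g (suc i) * (g zero * product (λ k → unless k i (g (suc k))))   ∎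

  unless-unless≈unlessEq : ∀ {m} (k i j : Fin m) a b →
    unless k j (unless k i (unless k i a * unless k j b)) ≈ unlessEq k i j (a * b)
  unless-unless≈unlessEq k i j a b with k ≟ i | k ≟ j
  ... | yes ≡.refl | _ = reflexive (≡.trans (≡.cong (unless k j) (unless-≡ k _)) (unless-1# k j))
  ... | no _ | yes ≡.refl = reflexive (unless-≡ k _)
  ... | no k≢i | no k≢j = reflexive (≡.trans (unless-≢ _ k≢j) (≡.trans (unless-≢ _ k≢i)
          (≡.cong₂ _*_ (unless-≢ a k≢i) (unless-≢ b k≢j))))

  ifLt-< : ∀ {m} {i j : Fin m} x → toℕ i < toℕ j → ifLt i j x ≈ x
  ifLt-< {i = i} {j} x i<j with toℕ i <? toℕ j
  ... | yes _  = refl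
  ... | no i≮j = ⊥-elim (i≮j i<j)

  ifLt-≮ : ∀ {m} {i j : Fin m} x → ¬ toℕ i < toℕ j → ifLt i j x ≈ 0#
  ifLt-≮ {i = i} {j} x i≮j with toℕ i <? toℕ j
  ... | yes i<j = ⊥-elim (i≮j i<j)
  ... | no _    = refl

  ifLt-self : ∀ {m} (i : Fin m) x → ifLt i i x ≈ 0#
  ifLt-self i x = ifLt-≮ {i = i} {i} x (ℕₚ.<-irrefl ≡.refl)

  ifLt-cong : ∀ {m} (i j : Fin m) {x y} → (toℕ i < toℕ j → x ≈ y) → ifLt i j x ≈ ifLt i j y
  ifLt-cong i j x≈y with toℕ i <? toℕ j
  ... | yes i<j = x≈y i<j
  ... | no _    = refl

  ifLt-distrib-+ : ∀ {m} (i j : Fin m) x y → ifLt i j (x + y) ≈ ifLt i j x + ifLt i j y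
  ifLt-distrib-+ i j x y with toℕ i <? toℕ j
  ... | yes _ = refl
  ... | no _  = sym (+-identityˡ 0#)

  ifLt+ifLt-flip : ∀ {m} (i j : Fin m) x → i ≢ j → ifLt i j x + ifLt j i x ≈ x
  ifLt+ifLt-flip i j x i≢j with ℕₚ.<-cmp (toℕ i) (toℕ j)
  ... | tri< i<j _ j≮i = trans (+-cong (ifLt-< x i<j) (ifLt-≮ x j≮i)) (+-identityʳ x)
  ... | tri≈ _ i≡j _   = ⊥-elim (i≢j (Finₚ.toℕ-injective i≡j))
  ... | tri> i≮j _ j<i = trans (+-cong (ifLt-≮ x i≮j) (ifLt-< x j<i)) (+-identityˡ x)

  ∑∑-ifLt-symmetrise : ∀ {m} (A : Fin m → Fin m → Carrier) → (∀ i → A i i ≈ 0#) →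
    ∑[ i < m ] ∑[ j < m ] ifLt i j (A i j + A j i) ≈ ∑[ i < m ] ∑[ j < m ] A i j
  ∑∑-ifLt-symmetrise {m} A Aᵢᵢ≈0 = begin
    ∑[ i < m ] ∑[ j < m ] ifLt i j (A i j + A j i)
      ≈⟨ sum-cong-≋ (λ i → sum-cong-≋ (λ j → ifLt-distrib-+ i j (A i j) (A j i))) ⟩
    ∑[ i < m ] ∑[ j < m ] (ifLt i j (A i j) + ifLt i j (A j i))
      ≈⟨ ∑∑-distrib-+ (λ i j → ifLt i j (A i j)) (λ i j → ifLt i j (A j i)) ⟩
    ∑[ i < m ] ∑[ j < m ] ifLt i j (A i j) + ∑[ i < m ] ∑[ j < m ] ifLt i j (A j i)
      ≈⟨ +-congˡ (∑-comm (λ i j → ifLt i j (A j i))) ⟩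
    ∑[ i < m ] ∑[ j < m ] ifLt i j (A i j) + ∑[ i < m ] ∑[ j < m ] ifLt j i (A i j)
      ≈⟨ ∑∑-distrib-+ (λ i j → ifLt i j (A i j)) (λ i j → ifLt j i (A i j)) ⟨
    ∑[ i < m ] ∑[ j < m ] (ifLt i j (A i j) + ifLt j i (A i j))
      ≈⟨ sum-cong-≋ (λ i → sum-cong-≋ (λ j → pairUp i j)) ⟩
    ∑[ i < m ] ∑[ j < m ] A i j   ∎
    where
    pairUp : ∀ i j → ifLt i j (A i j) + ifLt j i (A i j) ≈ A i j
    pairUp i j with i ≟ j
    ... | yes ≡.refl = begin
      ifLt i i (A i i) + ifLt i i (A i i)  ≈⟨ +-cong (ifLt-self i (A i i)) (ifLt-self i (A i i)) ⟩
      0# + 0#                              ≈⟨ +-identityˡ 0# ⟩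
      0#                                   ≈⟨ Aᵢᵢ≈0 i ⟨
      A i i                                ∎
    ... | no i≢j = ifLt+ifLt-flip i j (A i j) i≢j

  δ : ℕ → ℕ → Carrier
  δ zero    zero    = 1#
  δ zero    (suc b) = 0#
  δ (suc a) zero    = 0#
  δ (suc a) (suc b) = δ a b

  δ-≡ : ∀ a → δ a a ≡ 1#
  δ-≡ zero    = ≡.refl
  δ-≡ (suc a) = δ-≡ a

  δ-≢ : ∀ {a b} → a ≢ b → δ a b ≡ 0#
  δ-≢ {zero}  {zero}  a≢b = ⊥-elim (a≢b ≡.refl)
  δ-≢ {zero}  {suc b} a≢b = ≡.refl
  δ-≢ {suc a} {zero}  a≢b = ≡.refl
  δ-≢ {suc a} {suc b} a≢b = δ-≢ (a≢b ∘ ≡.cong suc)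

  ∑-*δ : ∀ {m} (g : Fin m → Carrier) {t} (t<m : t < m) → ∑[ a < m ] (g a * δ (toℕ a) t) ≈ g (fromℕ< t<m)
  ∑-*δ {suc m} g {zero} _ = begin
    g zero * 1# + ∑[ a < m ] (g (suc a) * 0#)   ≈⟨ +-cong (*-identityʳ _) (∑-0 (λ a → zeroʳ (g (suc a)))) ⟩
    g zero + 0#                                 ≈⟨ +-identityʳ _ ⟩
    g zero                                      ∎
  ∑-*δ {suc m} g {suc t} (s≤s t<m) = begin
    g zero * 0# + ∑[ a < m ] (g (suc a) * δ (toℕ a) t)   ≈⟨ +-cong (zeroʳ _) (∑-*δ (g ∘ suc) t<m) ⟩
    0# + g (suc (fromℕ< t<m))                            ≈⟨ +-identityˡ _ ⟩
    g (suc (fromℕ< t<m))                                 ∎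

  ∑-*δ≈dehom : ∀ d (F : HomPoly d) t → ∑[ a < suc d ] (F a * δ (toℕ a) t) ≈ dehom d F t
  ∑-*δ≈dehom d F t with t <? suc d
  ... | yes t<1+d = ∑-*δ F t<1+d
  ... | no  t≮1+d = ∑-0 (λ a → trans (*-congˡ {F a} (reflexive (δ-≢ (t≮1+d ∘ a≡t⇒t<1+d a)))) (zeroʳ (F a)))
    where
    a≡t⇒t<1+d : ∀ a → toℕ a ≡ t → t < suc d
    a≡t⇒t<1+d a a≡t = ≡.subst (_< suc d) a≡t (Finₚ.toℕ<n a)

  ∑-*[δ−δ]≈oneMinusX*-dehom : ∀ d (F : HomPoly d) t →
    ∑[ a < suc d ] (F a * (δ (toℕ a) t − δ (suc (toℕ a)) t)) ≈ coeff (oneMinusX* (dehom d F)) t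
  ∑-*[δ−δ]≈oneMinusX*-dehom d F t = begin
    ∑[ a < suc d ] (F a * (δ (toℕ a) t − δ (suc (toℕ a)) t))
      ≈⟨ sum-cong-≋ (λ a → x[y-z]≈xy-xz (F a) (δ (toℕ a) t) (δ (suc (toℕ a)) t)) ⟩
    ∑[ a < suc d ] (F a * δ (toℕ a) t − F a * δ (suc (toℕ a)) t)
      ≈⟨ ∑-distrib-− (λ a → F a * δ (toℕ a) t) (λ a → F a * δ (suc (toℕ a)) t) ⟩
    ∑[ a < suc d ] (F a * δ (toℕ a) t) − ∑[ a < suc d ] (F a * δ (suc (toℕ a)) t)
      ≈⟨ shifted t ⟩
    coeff (oneMinusX* (dehom d F)) t   ∎
    where
    shifted : ∀ t → ∑[ a < suc d ] (F a * δ (toℕ a) t) − ∑[ a < suc d ] (F a * δ (suc (toℕ a)) t)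
                    ≈ oneMinusX* (dehom d F) t
    shifted zero = begin
      ∑[ a < suc d ] (F a * δ (toℕ a) 0) − ∑[ a < suc d ] (F a * 0#)
        ≈⟨ +-cong (∑-*δ≈dehom d F 0) (-‿cong (∑-0 (λ a → zeroʳ (F a)))) ⟩
      dehom d F 0 − 0#
        ≈⟨ +-congˡ ε⁻¹≈ε ⟩
      dehom d F 0 + 0#
        ≈⟨ +-identityʳ _ ⟩
      dehom d F 0   ∎
    shifted (suc t) = +-cong (∑-*δ≈dehom d F (suc t)) (-‿cong (∑-*δ≈dehom d F t))

  -- Power sums over distinct points

  Distinct : ∀ {m} → (Fin m → Carrier) → Set ℓ
  Distinct {m} w = ∀ (i j : Fin m) → i ≢ j → w i ≉ w j

  Distinct-∘ : ∀ {m k} {w : Fin m → Carrier} {f : Fin k → Fin m} →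
               Injective _≡_ _≡_ f → Distinct w → Distinct (w ∘ f)
  Distinct-∘ f-injective w-distinct i j i≢j = w-distinct _ _ (i≢j ∘ f-injective)

  lagrangeDenom : ∀ {m} → (Fin m → Carrier) → Fin m → Carrier
  lagrangeDenom w i = product (λ k → unless k i (w i − w k))

  lagrangeDenom-≉0 : ∀ {m} {w : Fin m → Carrier} → Distinct w → ∀ i → lagrangeDenom w i ≉ 0#
  lagrangeDenom-≉0 {w = w} w-distinct i = product-≉0 _ factor≉0
    where
    factor≉0 : ∀ k → unless k i (w i − w k) ≉ 0#
    factor≉0 k with k ≟ i
    ... | yes ≡.refl = λ ≈0 → 0≉1 (sym (trans (reflexive (≡.sym (unless-≡ k _))) ≈0))
    ... | no k≢i = λ ≈0 → x≉y⇒x−y≉0 (w-distinct i k (k≢i ∘ ≡.sym))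
                            (trans (reflexive (≡.sym (unless-≢ _ k≢i))) ≈0)

  powerSum : ∀ {m} → ℕ → (Fin m → Carrier) → Carrier
  powerSum {m} e w = ∑[ i < m ] (w i ^ e ÷ lagrangeDenom w i)

  powerSum-suc : ∀ {m} {w : Fin (suc m) → Carrier} → Distinct w → ∀ e →
                 powerSum (suc e) w ≈ powerSum e (w ∘ suc) + w zero * powerSum e w
  powerSum-suc {m} {w} w-distinct e = begin
    ∑[ i < suc m ] (w i * w i ^ e * P i ⁻¹)
      ≈⟨ sum-cong-≋ (λ i → trans (*-assoc (w i) (w i ^ e) (P i ⁻¹))
                                  (x*y≈[x−z]*y+z*y (w i) (w i ^ e ÷ P i) (w zero))) ⟩
    ∑[ i < suc m ] ((w i − w zero) * (w i ^ e ÷ P i) + w zero * (w i ^ e ÷ P i))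
      ≈⟨ ∑-distrib-+ (λ i → (w i − w zero) * (w i ^ e ÷ P i)) (λ i → w zero * (w i ^ e ÷ P i)) ⟩
    ∑[ i < suc m ] ((w i − w zero) * (w i ^ e ÷ P i)) + ∑[ i < suc m ] (w zero * (w i ^ e ÷ P i))
      ≈⟨ +-cong dropFirst (sym (*-distribˡ-sum (w zero) (λ i → w i ^ e ÷ P i))) ⟩
    powerSum e (w ∘ suc) + w zero * powerSum e w   ∎
    where
    P : Fin (suc m) → Carrier
    P = lagrangeDenom w
    -- P (suc i) is definitionally (w (suc i) − w zero) * lagrangeDenom (w ∘ suc) i.
    dropFirst : ∑[ i < suc m ] ((w i − w zero) * (w i ^ e ÷ P i)) ≈ powerSum e (w ∘ suc)
    dropFirst = begin
      (w zero − w zero) * (w zero ^ e ÷ P zero) + ∑[ i < m ] ((w (suc i) − w zero) * (w (suc i) ^ e ÷ P (suc i)))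
        ≈⟨ +-cong (trans (*-congʳ (x≈y⇒x∙y⁻¹≈ε refl)) (zeroˡ _))
                  (sum-cong-≋ (λ i → x*[y÷xz]≈y÷z (x≉y⇒x−y≉0 (w-distinct (suc i) zero λ ()))
                                                   (lagrangeDenom-≉0 (Distinct-∘ Finₚ.suc-injective w-distinct) i))) ⟩
      0# + powerSum e (w ∘ suc)
        ≈⟨ +-identityˡ _ ⟩
      powerSum e (w ∘ suc)   ∎

  swap01 : ∀ {m} → Fin (suc (suc m)) → Fin (suc (suc m))
  swap01 zero          = suc zero
  swap01 (suc zero)    = zero
  swap01 (suc (suc i)) = suc (suc i)

  swap01-involutive : ∀ {m} (i : Fin (suc (suc m))) → swap01 (swap01 i) ≡ i
  swap01-involutive zero          = ≡.refl
  swap01-involutive (suc zero)    = ≡.refl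
  swap01-involutive (suc (suc i)) = ≡.refl

  swap01-injective : ∀ {m} → Injective _≡_ _≡_ (swap01 {m})
  swap01-injective {x = i} {j} σi≡σj =
    ≡.trans (≡.sym (swap01-involutive i)) (≡.trans (≡.cong swap01 σi≡σj) (swap01-involutive j))

  ∑-swap01 : ∀ {m} (f : Fin (suc (suc m)) → Carrier) → sum (f ∘ swap01) ≈ sum f
  ∑-swap01 f = x+[y+z]≈y+[x+z] (f (suc zero)) (f zero) _

  lagrangeDenom-swap01 : ∀ {m} (w : Fin (suc (suc m)) → Carrier) i →
                         lagrangeDenom (w ∘ swap01) i ≈ lagrangeDenom w (swap01 i)
  lagrangeDenom-swap01 w zero          = x∙yz≈y∙xz _ _ _
  lagrangeDenom-swap01 w (suc zero)    = x∙yz≈y∙xz _ _ _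
  lagrangeDenom-swap01 w (suc (suc i)) = x∙yz≈y∙xz _ _ _

  powerSum-swap01 : ∀ {m} {w : Fin (suc (suc m)) → Carrier} → Distinct w → ∀ e →
                    powerSum e (w ∘ swap01) ≈ powerSum e w
  powerSum-swap01 {m} {w} w-distinct e = begin
    ∑[ i < suc (suc m) ] (w (swap01 i) ^ e ÷ lagrangeDenom (w ∘ swap01) i)
      ≈⟨ sum-cong-≋ (λ i → *-congˡ {w (swap01 i) ^ e}
           (⁻¹-cong (lagrangeDenom-≉0 (Distinct-∘ swap01-injective w-distinct) i) (lagrangeDenom-swap01 w i))) ⟩
    ∑[ i < suc (suc m) ] (w (swap01 i) ^ e ÷ lagrangeDenom w (swap01 i))
      ≈⟨ ∑-swap01 (λ i → w i ^ e ÷ lagrangeDenom w i) ⟩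
    powerSum e w   ∎

  powerSum≈δ : ∀ m {w : Fin (suc m) → Carrier} → Distinct w → ∀ e → e ≤ m → powerSum e w ≈ δ e m
  powerSum≈δ zero _ zero z≤n = begin
    1# * (1# * 1#) ⁻¹ + 0#   ≈⟨ +-identityʳ _ ⟩
    1# * (1# * 1#) ⁻¹        ≈⟨ *-identityˡ _ ⟩
    (1# * 1#) ⁻¹             ≈⟨ ⁻¹-unique (trans (*-identityʳ _) (*-identityˡ 1#)) ⟨
    1#                       ∎
  -- Peeling w₀ or w₁ off S₁ gives w₀ S₀ = w₁ S₀.
  powerSum≈δ (suc m) {w} w-distinct zero z≤n =
    x≉y∧x*z≈y*z⇒z≈0 (w-distinct zero (suc zero) λ ()) (∙-cancelˡ _ _ _ (begin
      powerSum 0 (w ∘ suc) + w zero * powerSum 0 w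
        ≈⟨ powerSum-suc w-distinct 0 ⟨
      powerSum 1 w
        ≈⟨ powerSum-swap01 w-distinct 1 ⟨
      powerSum 1 (w ∘ swap01)
        ≈⟨ powerSum-suc wσ-distinct 0 ⟩
      powerSum 0 (w ∘ swap01 ∘ suc) + w (suc zero) * powerSum 0 (w ∘ swap01)
        ≈⟨ +-cong (trans (powerSum≈δ m (Distinct-∘ Finₚ.suc-injective wσ-distinct) 0 z≤n)
                         (sym (powerSum≈δ m (Distinct-∘ Finₚ.suc-injective w-distinct) 0 z≤n)))
                  (*-congˡ (powerSum-swap01 w-distinct 0)) ⟩
      powerSum 0 (w ∘ suc) + w (suc zero) * powerSum 0 w   ∎))
    where
    wσ-distinct : Distinct (w ∘ swap01)
    wσ-distinct = Distinct-∘ swap01-injective w-distinct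
  powerSum≈δ (suc m) {w} w-distinct (suc e) (s≤s e≤m) = begin
    powerSum (suc e) w
      ≈⟨ powerSum-suc w-distinct e ⟩
    powerSum e (w ∘ suc) + w zero * powerSum e w
      ≈⟨ +-cong (powerSum≈δ m (Distinct-∘ Finₚ.suc-injective w-distinct) e e≤m)
                (*-congˡ (powerSum≈δ (suc m) w-distinct e (ℕₚ.m≤n⇒m≤1+n e≤m))) ⟩
    δ e m + w zero * δ e (suc m)
      ≈⟨ +-congˡ (trans (*-congˡ (reflexive (δ-≢ (ℕₚ.<⇒≢ (s≤s e≤m))))) (zeroʳ _)) ⟩
    δ e m + 0#
      ≈⟨ +-identityʳ _ ⟩
    δ e m   ∎

  powerSum*powerSum≈δ : ∀ m {w : Fin (suc m) → Carrier} → Distinct w → ∀ p q → p ℕ.+ q ≡ m ℕ.+ m →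
                        powerSum p w * powerSum q w ≈ δ p m
  powerSum*powerSum≈δ m {w} w-distinct p q p+q≡m+m with ℕₚ.<-cmp p m
  ... | tri< p<m _ _ = begin
    powerSum p w * powerSum q w   ≈⟨ *-congʳ (trans (powerSum≈δ m w-distinct p (ℕₚ.<⇒≤ p<m)) δpm≈0) ⟩
    0# * powerSum q w             ≈⟨ zeroˡ _ ⟩
    0#                            ≈⟨ δpm≈0 ⟨
    δ p m                         ∎
    where
    δpm≈0 : δ p m ≈ 0#
    δpm≈0 = reflexive (δ-≢ (ℕₚ.<⇒≢ p<m))
  ... | tri≈ _ ≡.refl _ with ℕₚ.+-cancelˡ-≡ p q p p+q≡m+m
  ... | ≡.refl = begin
    powerSum p w * powerSum p w   ≈⟨ *-cong Sp≈1 Sp≈1 ⟩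
    1# * 1#                       ≈⟨ *-identityˡ 1# ⟩
    1#                            ≈⟨ reflexive (δ-≡ p) ⟨
    δ p p                         ∎
    where
    Sp≈1 : powerSum p w ≈ 1#
    Sp≈1 = trans (powerSum≈δ p w-distinct p ℕₚ.≤-refl) (reflexive (δ-≡ p))
  powerSum*powerSum≈δ m {w} w-distinct p q p+q≡m+m | tri> _ _ m<p = begin
    powerSum p w * powerSum q w   ≈⟨ *-congˡ (trans (powerSum≈δ m w-distinct q (ℕₚ.<⇒≤ q<m))
                                                        (reflexive (δ-≢ (ℕₚ.<⇒≢ q<m)))) ⟩
    powerSum p w * 0#             ≈⟨ zeroʳ _ ⟩
    0#                            ≈⟨ reflexive (δ-≢ (ℕₚ.<⇒≢ m<p ∘ ≡.sym)) ⟨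
    δ p m                         ∎
    where
    q<m : q < m
    q<m = ℕₚ.≰⇒> (λ m≤q → ℕₚ.<⇒≢ (ℕₚ.+-mono-<-≤ m<p m≤q) (≡.sym p+q≡m+m))

  -- Pairing the terms of the sum

  pairDenom : ∀ {m} → (Fin m → Carrier) → Fin m → Fin m → Carrier
  pairDenom {m} w i j = Π m (λ k → unlessEq k i j ((w i − w k) * (w j − w k)))

  pairDenom-lagrangeDenom : ∀ {m} (w : Fin m → Carrier) {i j} → i ≢ j →
    pairDenom w i j * ((w i − w j) * (w j − w i)) ≈ lagrangeDenom w i * lagrangeDenom w j
  pairDenom-lagrangeDenom {m} w {i} {j} i≢j = begin
    Q * ((w i − w j) * (w j − w i))
      ≈⟨ x∙yz≈z∙yx Q _ _ ⟩
    (w j − w i) * ((w i − w j) * Q)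
      ≈⟨ *-cong gᵢ≈ (*-cong gⱼ≈ (trans (product-cong (λ k → unless-unless≈unlessEq k i j (w i − w k) (w j − w k)))
                                       (reflexive (≡.sym (Π≡product m _))))) ⟨
    g i * (unless j i (g j) * product (λ k → unless k j (unless k i (g k))))
      ≈⟨ *-congˡ (product-extract (λ k → unless k i (g k)) j) ⟨
    g i * product (λ k → unless k i (g k))
      ≈⟨ product-extract g i ⟨
    product g
      ≈⟨ product-distrib-* (λ k → unless k i (w i − w k)) (λ k → unless k j (w j − w k)) ⟩
    lagrangeDenom w i * lagrangeDenom w j   ∎
    where
    Q : Carrier
    Q = pairDenom w i j
    g : Fin m → Carrier
    g k = unless k i (w i − w k) * unless k j (w j − w k)
    gᵢ≈ : g i ≈ w j − w i
    gᵢ≈ = trans (reflexive (≡.cong₂ _*_ (unless-≡ i _) (unless-≢ _ i≢j))) (*-identityˡ _)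
    gⱼ≈ : unless j i (g j) ≈ w i − w j
    gⱼ≈ = trans (reflexive (≡.trans (unless-≢ _ (i≢j ∘ ≡.sym))
                                    (≡.cong₂ _*_ (unless-≢ _ (i≢j ∘ ≡.sym)) (unless-≡ j _))))
                (*-identityʳ _)

  evalHom-sym : ∀ d (F : HomPoly d) → IsSymmetric d F → ∀ x y → evalHom d F y x ≈ evalHom d F x y
  evalHom-sym d F F-sym x y = begin
    Σ (suc d) t
      ≡⟨ Σ≡sum (suc d) t ⟩
    sum t
      ≈⟨ ∑-permute t reverse ⟩
    ∑[ a < suc d ] t (opposite a)
      ≈⟨ sum-cong-≋ t∘opposite≈ ⟩
    ∑[ a < suc d ] (F a * x ^ toℕ a * y ^ (d ∸ toℕ a))
      ≡⟨ Σ≡sum (suc d) (λ a → F a * x ^ toℕ a * y ^ (d ∸ toℕ a)) ⟨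
    evalHom d F x y   ∎
    where
    t : Fin (suc d) → Carrier
    t a = F a * y ^ toℕ a * x ^ (d ∸ toℕ a)
    t∘opposite≈ : ∀ a → t (opposite a) ≈ F a * x ^ toℕ a * y ^ (d ∸ toℕ a)
    t∘opposite≈ a = begin
      F (opposite a) * y ^ toℕ (opposite a) * x ^ (d ∸ toℕ (opposite a))
        ≡⟨ ≡.cong₂ (λ k l → F (opposite a) * y ^ k * x ^ l) toℕ-opposite
                   (≡.trans (≡.cong (d ∸_) toℕ-opposite) (ℕₚ.m∸[m∸n]≡n a≤d)) ⟩
      F (opposite a) * y ^ (d ∸ toℕ a) * x ^ toℕ a
        ≈⟨ *-congʳ (*-congʳ (F-sym (opposite a) a
             (≡.trans (≡.cong (ℕ._+ toℕ a) toℕ-opposite) (ℕₚ.m∸n+n≡m a≤d)))) ⟩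
      F a * y ^ (d ∸ toℕ a) * x ^ toℕ a
        ≈⟨ xy∙z≈xz∙y (F a) _ _ ⟩
      F a * x ^ toℕ a * y ^ (d ∸ toℕ a)   ∎
      where
      a≤d : toℕ a ≤ d
      a≤d = Finₚ.toℕ≤pred[n] a
      toℕ-opposite : toℕ (opposite a) ≡ d ∸ toℕ a
      toℕ-opposite = Finₚ.opposite-prop a

  module _ (d : ℕ) (F : HomPoly d) {m} (w : Fin m → Carrier) where

    private
      P : Fin m → Carrier
      P = lagrangeDenom w
      E : Fin m → Fin m → Carrier
      E i j = evalHom d F (w i) (w j)

    halfTerm : Fin m → Fin m → Carrier
    halfTerm i j = E i j * ((w j − w i) * w i) * (P i ⁻¹ * P j ⁻¹)

    halfTerm-diagonal : ∀ i → halfTerm i i ≈ 0#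
    halfTerm-diagonal i = begin
      E i i * ((w i − w i) * w i) * (P i ⁻¹ * P i ⁻¹)   ≈⟨ *-congʳ (*-congˡ (*-congʳ (x≈y⇒x∙y⁻¹≈ε refl))) ⟩
      E i i * (0# * w i) * (P i ⁻¹ * P i ⁻¹)            ≈⟨ *-congʳ (*-congˡ (zeroˡ (w i))) ⟩
      E i i * 0# * (P i ⁻¹ * P i ⁻¹)                    ≈⟨ *-congʳ (zeroʳ (E i i)) ⟩
      0# * (P i ⁻¹ * P i ⁻¹)                            ≈⟨ zeroˡ _ ⟩
      0#                                                ∎

    pairTerm-split : IsSymmetric d F → Distinct w → ∀ {i j} → i ≢ j →
                     E i j ÷ pairDenom w i j ≈ halfTerm i j + halfTerm j i
    pairTerm-split F-sym w-distinct {i} {j} i≢j = begin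
      E i j * pairDenom w i j ⁻¹
        ≈⟨ *-congˡ (x*y≈z⇒x⁻¹≈y÷z (pairDenom-lagrangeDenom w i≢j) (x≉0∧y≉0⇒x*y≉0 Pᵢ≉0 Pⱼ≉0)) ⟩
      E i j * ((w i − w j) * (w j − w i) ÷ (P i * P j))
        ≈⟨ *-congˡ (*-cong ([a−b]*[b−a]≈[b−a]*a+[a−b]*b (w i) (w j)) (⁻¹-distrib-* Pᵢ≉0 Pⱼ≉0)) ⟩
      E i j * (((w j − w i) * w i + (w i − w j) * w j) * (P i ⁻¹ * P j ⁻¹))
        ≈⟨ *-assoc _ _ _ ⟨
      E i j * ((w j − w i) * w i + (w i − w j) * w j) * (P i ⁻¹ * P j ⁻¹)
        ≈⟨ *-congʳ (distribˡ (E i j) _ _) ⟩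
      (E i j * ((w j − w i) * w i) + E i j * ((w i − w j) * w j)) * (P i ⁻¹ * P j ⁻¹)
        ≈⟨ distribʳ _ _ _ ⟩
      halfTerm i j + E i j * ((w i − w j) * w j) * (P i ⁻¹ * P j ⁻¹)
        ≈⟨ +-congˡ (*-cong (*-congʳ (evalHom-sym d F F-sym (w i) (w j))) (*-comm _ _)) ⟨
      halfTerm i j + halfTerm j i   ∎
      where
      Pᵢ≉0 : P i ≉ 0#
      Pᵢ≉0 = lagrangeDenom-≉0 w-distinct i
      Pⱼ≉0 : P j ≉ 0#
      Pⱼ≉0 = lagrangeDenom-≉0 w-distinct j

    private
      U : ℕ → Fin m → Carrier
      U e i = w i ^ e ÷ P i

    halfTermMonomial : Fin (suc d) → Fin m → Fin m → Carrier
    halfTermMonomial a i j = F a * (U (suc (toℕ a)) i * U (suc (d ∸ toℕ a)) j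
                                    − U (suc (suc (toℕ a))) i * U (d ∸ toℕ a) j)

    halfTerm-expand : ∀ i j → halfTerm i j ≈ ∑[ a < suc d ] halfTermMonomial a i j
    halfTerm-expand i j = begin
      E i j * M * PP
        ≡⟨ ≡.cong (λ s → s * M * PP) (Σ≡sum (suc d) t) ⟩
      sum t * M * PP
        ≈⟨ *-congʳ (*-distribʳ-sum M t) ⟩
      ∑[ a < suc d ] (t a * M) * PP
        ≈⟨ *-distribʳ-sum PP (λ a → t a * M) ⟩
      ∑[ a < suc d ] (t a * M * PP)
        ≈⟨ sum-cong-≋ (λ a → monomial-split (F a) (w i ^ toℕ a) (w j ^ (d ∸ toℕ a))
                                             (w i) (w j) (P i ⁻¹) (P j ⁻¹)) ⟩
      ∑[ a < suc d ] halfTermMonomial a i j   ∎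
      where
      M PP : Carrier
      M = (w j − w i) * w i
      PP = P i ⁻¹ * P j ⁻¹
      t : Fin (suc d) → Carrier
      t a = F a * w i ^ toℕ a * w j ^ (d ∸ toℕ a)

    ∑∑-halfTermMonomial : ∀ a → ∑[ i < m ] ∑[ j < m ] halfTermMonomial a i j ≈
      F a * (powerSum (suc (toℕ a)) w * powerSum (suc (d ∸ toℕ a)) w
             − powerSum (suc (suc (toℕ a))) w * powerSum (d ∸ toℕ a) w)
    ∑∑-halfTermMonomial a = begin
      ∑[ i < m ] ∑[ j < m ] (F a * (U p i * U q j − U p′ i * U q′ j))
        ≈⟨ sum-cong-≋ (λ i → *-distribˡ-sum (F a) (λ j → U p i * U q j − U p′ i * U q′ j)) ⟨
      ∑[ i < m ] (F a * ∑[ j < m ] (U p i * U q j − U p′ i * U q′ j))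
        ≈⟨ *-distribˡ-sum (F a) (λ i → ∑[ j < m ] (U p i * U q j − U p′ i * U q′ j)) ⟨
      F a * ∑[ i < m ] ∑[ j < m ] (U p i * U q j − U p′ i * U q′ j)
        ≈⟨ *-congˡ (∑∑-separable-− (U p) (U q) (U p′) (U q′)) ⟩
      F a * (powerSum p w * powerSum q w − powerSum p′ w * powerSum q′ w)   ∎
      where
      p q p′ q′ : ℕ
      p = suc (toℕ a)
      q = suc (d ∸ toℕ a)
      p′ = suc p
      q′ = d ∸ toℕ a

    ∑∑-halfTerm : ∑[ i < m ] ∑[ j < m ] halfTerm i j ≈
      ∑[ a < suc d ] (F a * (powerSum (suc (toℕ a)) w * powerSum (suc (d ∸ toℕ a)) w
                             − powerSum (suc (suc (toℕ a))) w * powerSum (d ∸ toℕ a) w))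
    ∑∑-halfTerm = begin
      ∑[ i < m ] ∑[ j < m ] halfTerm i j
        ≈⟨ sum-cong-≋ (λ i → sum-cong-≋ (halfTerm-expand i)) ⟩
      ∑[ i < m ] ∑[ j < m ] ∑[ a < suc d ] halfTermMonomial a i j
        ≈⟨ sum-cong-≋ (λ i → ∑-comm (λ j a → halfTermMonomial a i j)) ⟩
      ∑[ i < m ] ∑[ a < suc d ] ∑[ j < m ] halfTermMonomial a i j
        ≈⟨ ∑-comm (λ i a → ∑[ j < m ] halfTermMonomial a i j) ⟩
      ∑[ a < suc d ] ∑[ i < m ] ∑[ j < m ] halfTermMonomial a i j
        ≈⟨ sum-cong-≋ ∑∑-halfTermMonomial ⟩
      ∑[ a < suc d ] (F a * (powerSum (suc (toℕ a)) w * powerSum (suc (d ∸ toℕ a)) w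
                             − powerSum (suc (suc (toℕ a))) w * powerSum (d ∸ toℕ a) w))   ∎

  theSum≡∑∑ : ∀ n d F (w : Fin (suc n) → Carrier) →
    theSum n d F w ≡ ∑[ i < suc n ] ∑[ j < suc n ] ifLt i j (evalHom d F (w i) (w j) ÷ pairDenom w i j)
  theSum≡∑∑ n d F w =
    ≡.trans (Σ≡sum (suc n) (λ i → Σ (suc n) (term i))) (sum-cong-≗ (λ i → Σ≡sum (suc n) (term i)))
    where
    term : Fin (suc n) → Fin (suc n) → Carrier
    term i j = ifLt i j (evalHom d F (w i) (w j) ÷ pairDenom w i j)

  theSum≈coeff : ∀ n d → 2 ℕ.+ d ≡ suc n ℕ.+ suc n → (F : HomPoly d) → IsSymmetric d F →
                 {w : Fin (suc (suc n)) → Carrier} → Distinct w →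
                 theSum (suc n) d F w ≈ coeff (oneMinusX* (dehom d F)) n
  theSum≈coeff n d 2+d≡ F F-sym {w} w-distinct = begin
    theSum (suc n) d F w
      ≡⟨ theSum≡∑∑ (suc n) d F w ⟩
    ∑[ i < suc (suc n) ] ∑[ j < suc (suc n) ] ifLt i j (evalHom d F (w i) (w j) ÷ pairDenom w i j)
      ≈⟨ sum-cong-≋ (λ i → sum-cong-≋ (λ j → ifLt-cong i j (λ i<j →
           pairTerm-split d F w F-sym w-distinct (ℕₚ.<⇒≢ i<j ∘ ≡.cong toℕ)))) ⟩
    ∑[ i < suc (suc n) ] ∑[ j < suc (suc n) ] ifLt i j (halfTerm d F w i j + halfTerm d F w j i)
      ≈⟨ ∑∑-ifLt-symmetrise (halfTerm d F w) (halfTerm-diagonal d F w) ⟩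
    ∑[ i < suc (suc n) ] ∑[ j < suc (suc n) ] halfTerm d F w i j
      ≈⟨ ∑∑-halfTerm d F w ⟩
    ∑[ a < suc d ] (F a * (S (suc (toℕ a)) * S (suc (d ∸ toℕ a)) − S (suc (suc (toℕ a))) * S (d ∸ toℕ a)))
      ≈⟨ sum-cong-≋ (λ a → *-congˡ {F a} (+-cong (S*S≈δ (suc (toℕ a)) (suc (d ∸ toℕ a)) (exponents₁ a))
                                           (-‿cong (S*S≈δ (suc (suc (toℕ a))) (d ∸ toℕ a) (exponents₂ a))))) ⟩
    ∑[ a < suc d ] (F a * (δ (toℕ a) n − δ (suc (toℕ a)) n))
      ≈⟨ ∑-*[δ−δ]≈oneMinusX*-dehom d F n ⟩
    coeff (oneMinusX* (dehom d F)) n   ∎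
    where
    S : ℕ → Carrier
    S e = powerSum e w
    S*S≈δ : ∀ p q → p ℕ.+ q ≡ suc n ℕ.+ suc n → S p * S q ≈ δ p (suc n)
    S*S≈δ = powerSum*powerSum≈δ (suc n) w-distinct
    a+[d∸a]≡d : ∀ (a : Fin (suc d)) → toℕ a ℕ.+ (d ∸ toℕ a) ≡ d
    a+[d∸a]≡d a = ℕₚ.m+[n∸m]≡n (Finₚ.toℕ≤pred[n] a)
    exponents₂ : ∀ (a : Fin (suc d)) → suc (suc (toℕ a)) ℕ.+ (d ∸ toℕ a) ≡ suc n ℕ.+ suc n
    exponents₂ a = ≡.trans (≡.cong (2 ℕ.+_) (a+[d∸a]≡d a)) 2+d≡
    exponents₁ : ∀ (a : Fin (suc d)) → suc (toℕ a) ℕ.+ suc (d ∸ toℕ a) ≡ suc n ℕ.+ suc n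
    exponents₁ a = ≡.trans (≡.cong suc (ℕₚ.+-suc (toℕ a) (d ∸ toℕ a))) (exponents₂ a)

2+deg : ∀ n → 1 ≤ n → 2 ℕ.+ deg n ≡ n ℕ.+ n
2+deg n 1≤n = ≡.trans (ℕₚ.m+[n∸m]≡n (ℕₚ.*-monoʳ-≤ 2 1≤n)) (≡.cong (n ℕ.+_) (ℕₚ.+-identityʳ n))

corollary2 : {c ℓ : Level} (K : Field c ℓ) → let open FieldOps K in
    (n : ℕ) → 1 ≤ n → (F : HomPoly (deg n)) → IsSymmetric (deg n) F →
    ((w w′ : Fin (suc n) → Carrier) →
      (∀ i j → ¬ (i ≡ j) → ¬ (w i ≈ w j)) → (∀ i j → ¬ (i ≡ j) → ¬ (w′ i ≈ w′ j)) →
      theSum n (deg n) F w ≈ theSum n (deg n) F w′)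
    × ((w : Fin (suc n) → Carrier) → (∀ i j → ¬ (i ≡ j) → ¬ (w i ≈ w j)) →
      theSum n (deg n) F w ≈ coeff (oneMinusX* (dehom (deg n) F)) (n ∸ 1))
corollary2 K (suc n) 1≤n F F-sym =
  (λ w w′ w-distinct w′-distinct → trans (value w-distinct) (sym (value w′-distinct))) ,
  (λ w w-distinct → value w-distinct)
  where
  open FieldOps K using (Carrier; _≈_; trans; sym; theSum; coeff; oneMinusX*; dehom)
  value : ∀ {w : Fin (suc (suc n)) → Carrier} → Distinct K w →
          theSum (suc n) (deg (suc n)) F w ≈ coeff (oneMinusX* (dehom (deg (suc n)) F)) n
  value = theSum≈coeff K n (deg (suc n)) (2+deg (suc n) 1≤n) F F-sym
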